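{- Let $G=(V,E)$ be a finite simple undirected graph with totally ordered vertex set $V$, and let $S'$ be as in the context. For $y\in V$ let $R[y]=\rho$ if $(y,\rho)\in S'$ (this $\rho$ is unique), and let $R[y]$ be undefined otherwise. Define a partial mapping $f:V\to V$ as follows: for each $x\in N[\mathrm{wit}(S')]$, let $\mathrm{refs}(x)=\{R[y]: y\in N[x],\ R[y]\text{ defined},\ R[y]\in N(x)\}$; if $\mathrm{refs}(x)=\emptyset$, $f(x)$ is undefined, and otherwise $f(x)$ is the element $r\in\mathrm{refs}(x)$ of minimum degree, ties broken by the smallest vertex; for $x\notin N[\mathrm{wit}(S')]$, $f(x)$ is undefined. Then $f$ is properly partitioning with respect to $S$.
   Context: For $u\in V$, $N(u)$ is the open neighbourhood, $N[u]=N(u)\cup\{u\}$, $\deg(u)=|N(u)|$, and for $X\subseteq V$, $N[X]=\bigcup_{u\in X}N[u]$. For $\rho\in V$: $N_1(\rho)=\{u\in N(\rho): N(u)\setminus N[\rho]\neq\emptyset\}$; $N_2(\rho)=\{u\in N(\rho)\setminus N_1(\rho): N(u)\cap N_1(\rho)\neq\emptyset\}$; $N_3(\rho)=N(\rho)\setminus N_1(\rho)\setminus N_2(\rho)$. Let $C=\{(u,\rho): \rho\in V,\ u\in N_3(\rho)\}$, $\mathrm{canRef}(u)=\arg\max_{v\in N[u]}(\deg(v),v)$ in lexicographic order (largest degree, ties broken by largest vertex), $S=\{(u,\rho)\in C:\ \rho=\mathrm{canRef}(u)\}$, and $S'=\{(u,\mathrm{canRef}(u)) : u\in V,\ \mathrm{canRef}(u)\neq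 u,\ N(u)\subseteq N[\mathrm{canRef}(u)]\}$. For a set $X$ of pairs, $\mathrm{wit}(X)=\{u:(u,\rho)\in X\}$. A partial mapping $f:V\to V$ is properly partitioning with respect to $S$ if for all $(u,\rho)\in S$ and all $x\in N[u]\setminus\{\rho\}$ we have $f(x)=\rho$. -}

module Defs where

open import Data.Nat using (ℕ; _<ᵇ_; _≡ᵇ_; _<_)
open import Data.Fin using (Fin; toℕ; _≟_)
open import Data.Bool using (Bool; true; false; _∧_; _∨_; not; if_then_else_)
open import Data.Maybe using (Maybe; just; nothing; is-just)
open import Data.List using (List; []; _∷_; allFin; filterᵇ; length; foldr; mapMaybe)
open import Data.Bool.ListAction using (any; all)
open import Data.Product using (Σ; _×_)
open import Data.Sum using (_⊎_)
open import Relation.Nullary using (¬_)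
open import Relation.Nullary.Decidable using (⌊_⌋)
open import Relation.Binary.PropositionalEquality using (_≡_)

-- A finite simple undirected graph on the totally ordered vertex set Fin n
-- (order = the usual order on Fin n), given by a symmetric irreflexive
-- Boolean adjacency relation.
record Graph (n : ℕ) : Set where
  field
    adj    : Fin n → Fin n → Bool
    sym    : ∀ u v → adj u v ≡ adj v u
    irrefl : ∀ u → adj u u ≡ false

module _ {n : ℕ} (G : Graph n) where
  open Graph G

  InN : Fin n → Fin n → Set
  InN u v = adj u v ≡ true

  InN[] : Fin n → Fin n → Set
  InN[] u v = v ≡ u ⊎ adj u v ≡ true

  inN[]ᵇ : Fin n → Fin n → Bool
  inN[]ᵇ u v = ⌊ v ≟ u ⌋ ∨ adj u v

  deg : Fin n → ℕ
  deg u = length (filterᵇ (adj u) (allFin n))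

  keyLtᵇ : Fin n → Fin n → Bool
  keyLtᵇ a b = (deg a <ᵇ deg b) ∨ ((deg a ≡ᵇ deg b) ∧ (toℕ a <ᵇ toℕ b))

  canRef : Fin n → Fin n
  canRef u = foldr (λ v best → if keyLtᵇ best v then v else best) u
                   (filterᵇ (inN[]ᵇ u) (allFin n))

  N₁ : Fin n → Fin n → Set
  N₁ ρ u = InN ρ u × Σ (Fin n) (λ w → InN u w × ¬ InN[] ρ w)

  N₂ : Fin n → Fin n → Set
  N₂ ρ u = InN ρ u × ¬ N₁ ρ u × Σ (Fin n) (λ w → InN u w × N₁ ρ w)

  N₃ : Fin n → Fin n → Set
  N₃ ρ u = InN ρ u × ¬ N₁ ρ u × ¬ N₂ ρ u

  InC : Fin n → Fin n → Set
  InC u ρ = N₃ ρ u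

  InS : Fin n → Fin n → Set
  InS u ρ = InC u ρ × ρ ≡ canRef u

  -- R[y] = ρ if (y , ρ) ∈ S', undefined otherwise, where
  -- (y , canRef y) ∈ S'  iff  canRef y ≠ y and N(y) ⊆ N[canRef y]
  R : Fin n → Maybe (Fin n)
  R y = if not ⌊ canRef y ≟ y ⌋ ∧ all (λ w → not (adj y w) ∨ inN[]ᵇ (canRef y) w) (allFin n)
        then just (canRef y) else nothing

  inNWitᵇ : Fin n → Bool
  inNWitᵇ x = any (λ y → is-just (R y) ∧ inN[]ᵇ y x) (allFin n)

  refs : Fin n → List (Fin n)
  refs x = mapMaybe pick (allFin n)
    where
      pickR : Maybe (Fin n) → Maybe (Fin n)
      pickR nothing  = nothing
      pickR (just r) = if adj x r then just r else nothing
      pick : Fin n → Maybe (Fin n)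
      pick y = if inN[]ᵇ x y then pickR (R y) else nothing

  argmin : List (Fin n) → Maybe (Fin n)
  argmin [] = nothing
  argmin (r ∷ rs) with argmin rs
  ... | nothing = just r
  ... | just m  = if keyLtᵇ m r then just m else just r

  f : Fin n → Maybe (Fin n)
  f x = if inNWitᵇ x then argmin (refs x) else nothing

  ProperlyPartitioning : (Fin n → Maybe (Fin n)) → Set
  ProperlyPartitioning g =
    ∀ u ρ → InS u ρ → ∀ x → InN[] u x → ¬ x ≡ ρ → g x ≡ just ρ

{-# OPTIONS --safe #-}
-- Let (u , ρ) ∈ S and x ∈ N[u] ∖ {ρ}.  Since u ∉ N₁(ρ) we have N(u) ⊆ N[ρ], and ρ = canRef u
-- differs from its neighbour u; so (u , ρ) ∈ S', and u witnesses both x ∈ N[wit(S')] and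
-- ρ = R[u] ∈ refs(x) (x ~ ρ because x ∈ N[u] ∖ {ρ} ⊆ N(ρ)).  Since u ∉ N₂(ρ), moreover
-- N[x] ⊆ N[ρ].  Any r ∈ refs(x) is canRef y for some y ∈ N[x] ⊆ N[ρ]; then ρ ∈ N[y], and canRef y
-- maximises (deg , vertex) over N[y], so r is not below ρ.  Hence ρ is the (deg , vertex)-least
-- element of refs(x), i.e. f(x) = ρ.
module Submission where

open import Defs
open import Data.Bool using (true; false; T; T?; not; _∨_; if_then_else_)
open import Data.Bool.Properties using (T-≡; T-∧)
open import Data.Fin using (Fin; toℕ; _≟_)
open import Data.Fin.Properties using (toℕ-injective)
open import Data.List using (List; []; _∷_; allFin; filterᵇ; foldr; mapMaybe)
open import Data.List.Membership.Propositional using (_∈_; lose)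
open import Data.List.Membership.Propositional.Properties using (∈-allFin; ∈-filter⁺)
open import Data.List.Relation.Unary.All using (universal)
open import Data.List.Relation.Unary.All.Properties using (all⁻)
open import Data.List.Relation.Unary.Any using (here; there)
open import Data.List.Relation.Unary.Any.Properties using (any⁺)
open import Data.Maybe using (Maybe; just; nothing; is-just)
open import Data.Maybe.Properties using (just-injective)
open import Data.Nat using (ℕ; _<_; _≡ᵇ_)
open import Data.Nat.Properties using (<-trans; <-cmp; <ᵇ-reflects-<; ≡ᵇ⇒≡; ≡⇒≡ᵇ)
open import Data.Product using (∃; _×_; _,_; proj₂; map₁; map₂)
open import Data.Product.Relation.Binary.Lex.Strict using (×-Lex; ×-transitive; ×-compare)
open import Data.Sum using (inj₁; inj₂)
open import Function using (_on_; _∘_; Equivalence)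
open import Level using (0ℓ)
open import Relation.Binary.Core using (Rel)
open import Relation.Binary.Definitions
  using (Transitive; Asymmetric; Cotransitive; Trichotomous; tri<; tri≈; tri>)
open import Relation.Binary.Consequences using (tri⇒asym; tri⇒irr; cotrans⇒¬-trans)
open import Relation.Binary.PropositionalEquality
  using (_≡_; _≢_; refl; sym; trans; cong; subst; resp₂; isEquivalence; module ≡-Reasoning)
open import Relation.Nullary
  using (¬_; Dec; yes; no; _because_; contradiction; contraposition)
open import Relation.Nullary.Decidable using (⌊_⌋; decidable-stable)
open import Relation.Nullary.Reflects
  using ( Reflects; ofʸ; ofⁿ; fromEquivalence; T-reflects; ¬-reflects
        ; _×-reflects_; _⊎-reflects_; _→-reflects_ )

if-T : ∀ {A : Set} {b} {t e : A} → T b → (if b then t else e) ≡ t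
if-T {b = true} _ = refl

if-then-≢ : ∀ {A : Set} {b} {t e v : A} → T b → ¬ (if b then t else e) ≡ v → ¬ t ≡ v
if-then-≢ {b = true} _ t≢v = t≢v

if-nothing≡just⇒T : ∀ {A : Set} {b} {t : Maybe A} {r} →
                    (if b then t else nothing) ≡ just r → T b × t ≡ just r
if-nothing≡just⇒T {b = true} t≡r = _ , t≡r

reflects⇒T : ∀ {A : Set} {b} → Reflects A b → A → T b
reflects⇒T (ofʸ _)  _ = _
reflects⇒T (ofⁿ ¬a) a = ¬a a

T⇒reflected : ∀ {A : Set} {b} → Reflects A b → T b → A
T⇒reflected (ofʸ a) _ = a

≡true-reflects : ∀ b → Reflects (b ≡ true) b
≡true-reflects b = fromEquivalence (Equivalence.to T-≡) (Equivalence.from T-≡)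

⌊⌋-reflects : ∀ {A : Set} (a? : Dec A) → Reflects A ⌊ a? ⌋
⌊⌋-reflects (yes a) = ofʸ a
⌊⌋-reflects (no ¬a) = ofⁿ ¬a

≡ᵇ-reflects-≡ : ∀ m n → Reflects (m ≡ n) (m ≡ᵇ n)
≡ᵇ-reflects-≡ m n = fromEquivalence (≡ᵇ⇒≡ m n) (≡⇒≡ᵇ m n)

∈-mapMaybe⁺ : ∀ {A B : Set} (g : A → Maybe B) {xs : List A} {y r} →
              y ∈ xs → g y ≡ just r → r ∈ mapMaybe g xs
∈-mapMaybe⁺ g (here refl) gy≡r rewrite gy≡r = here refl
∈-mapMaybe⁺ g {x ∷ _} (there y∈xs) gy≡r with g x
... | just _  = there (∈-mapMaybe⁺ g y∈xs gy≡r)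
... | nothing = ∈-mapMaybe⁺ g y∈xs gy≡r

∈-mapMaybe⁻ : ∀ {A B : Set} (g : A → Maybe B) {xs : List A} {r} →
              r ∈ mapMaybe g xs → ∃ λ y → y ∈ xs × g y ≡ just r
∈-mapMaybe⁻ g {x ∷ _} r∈ with g x in gx≡
∈-mapMaybe⁻ g (here refl)  | just _  = _ , here refl , gx≡
∈-mapMaybe⁻ g (there r∈)   | just _  = map₂ (map₁ there) (∈-mapMaybe⁻ g r∈)
∈-mapMaybe⁻ g r∈           | nothing = map₂ (map₁ there) (∈-mapMaybe⁻ g r∈)

module LexOrder {n : ℕ} (weight : Fin n → ℕ) where

  key : Fin n → ℕ × ℕ
  key v = weight v , toℕ v

  infix 4 _≺_ _⊀_
  _≺_ : Rel (Fin n) 0ℓ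
  _≺_ = ×-Lex _≡_ _<_ _<_ on key

  _⊀_ : Rel (Fin n) 0ℓ
  a ⊀ b = ¬ a ≺ b

  ≺-trans : Transitive _≺_
  ≺-trans = ×-transitive {_≈₁_ = _≡_} {_<₁_ = _<_} {_<₂_ = _<_}
              isEquivalence (resp₂ _<_) <-trans <-trans

  ≺-cmp : Trichotomous _≡_ _≺_
  ≺-cmp a b with ×-compare sym <-cmp <-cmp (key a) (key b)
  ... | tri< a≺b _ b⊀a         = tri< a≺b (λ { refl → b⊀a a≺b }) b⊀a
  ... | tri≈ a⊀b (_ , toℕ≡) b⊀a = tri≈ a⊀b (toℕ-injective toℕ≡) b⊀a
  ... | tri> a⊀b _ b≺a         = tri> a⊀b (λ { refl → a⊀b b≺a }) b≺a

  ≺-irrefl : ∀ {a} → a ⊀ a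
  ≺-irrefl = tri⇒irr ≺-cmp refl

  ≺-asym : Asymmetric _≺_
  ≺-asym = tri⇒asym ≺-cmp

  ≺-cotrans : Cotransitive _≺_
  ≺-cotrans {a} a≺b c with ≺-cmp a c
  ... | tri< a≺c _ _    = inj₁ a≺c
  ... | tri≈ _ refl _   = inj₂ a≺b
  ... | tri> _ _ c≺a    = inj₂ (≺-trans c≺a a≺b)

  ⊀-trans : Transitive _⊀_
  ⊀-trans = cotrans⇒¬-trans ≺-cotrans

  ⊀-antisym : ∀ {a b} → a ⊀ b → b ⊀ a → a ≡ b
  ⊀-antisym {a} {b} a⊀b b⊀a with ≺-cmp a b
  ... | tri< a≺b _ _ = contradiction a≺b a⊀b
  ... | tri≈ _ a≡b _ = a≡b
  ... | tri> _ _ b≺a = contradiction b≺a b⊀a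

module Partition {n : ℕ} (G : Graph n) where

  open Graph G using (adj) renaming (sym to adj-sym; irrefl to adj-irrefl)
  open LexOrder (deg G) public

  keyLtᵇ-reflects : ∀ a b → Reflects (a ≺ b) (keyLtᵇ G a b)
  keyLtᵇ-reflects a b =
    <ᵇ-reflects-< _ _ ⊎-reflects (≡ᵇ-reflects-≡ _ _ ×-reflects <ᵇ-reflects-< _ _)

  inN[]ᵇ-reflects : ∀ u v → Reflects (InN[] G u v) (inN[]ᵇ G u v)
  inN[]ᵇ-reflects u v = ⌊⌋-reflects (v ≟ u) ⊎-reflects ≡true-reflects (adj u v)

  InN[]? : ∀ u v → Dec (InN[] G u v)
  InN[]? u v = inN[]ᵇ G u v because inN[]ᵇ-reflects u v

  InN[]⇒T : ∀ {u v} → InN[] G u v → T (inN[]ᵇ G u v)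
  InN[]⇒T = reflects⇒T (inN[]ᵇ-reflects _ _)

  InN-sym : ∀ {u v} → InN G u v → InN G v u
  InN-sym {u} {v} u~v = trans (adj-sym v u) u~v

  InN[]-sym : ∀ {u v} → InN[] G u v → InN[] G v u
  InN[]-sym (inj₁ refl) = inj₁ refl
  InN[]-sym (inj₂ u~v)  = inj₂ (InN-sym u~v)

  InN⇒≢ : ∀ {u v} → InN G u v → u ≢ v
  InN⇒≢ {u} u~u refl with trans (sym (adj-irrefl u)) u~u
  ... | ()

  InN[]⇒InN : ∀ {u v} → InN[] G u v → v ≢ u → InN G u v
  InN[]⇒InN (inj₁ v≡u) v≢u = contradiction v≡u v≢u
  InN[]⇒InN (inj₂ u~v) _   = u~v

  infix 4 _N⊆N[_] N[_]⊆N[_]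
  _N⊆N[_] : Fin n → Fin n → Set
  u N⊆N[ v ] = ∀ {w} → InN G u w → InN[] G v w

  N[_]⊆N[_] : Fin n → Fin n → Set
  N[ u ]⊆N[ v ] = ∀ {w} → InN[] G u w → InN[] G v w

  ¬N₁⇒N⊆N[] : ∀ {ρ u} → InN G ρ u → ¬ N₁ G ρ u → u N⊆N[ ρ ]
  ¬N₁⇒N⊆N[] {ρ} ρ~u ¬N₁ {w} u~w =
    decidable-stable (InN[]? ρ w) (λ w∉N[ρ] → ¬N₁ (ρ~u , w , u~w , w∉N[ρ]))

  N⊆N[]⇒N[]⊆N[] : ∀ {ρ x} → InN G ρ x → x N⊆N[ ρ ] → N[ x ]⊆N[ ρ ]
  N⊆N[]⇒N[]⊆N[] ρ~x _   (inj₁ refl) = inj₂ ρ~x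
  N⊆N[]⇒N[]⊆N[] _   x⊆ρ (inj₂ x~y)  = x⊆ρ x~y

  N₃⇒InN : ∀ {ρ u x} → N₃ G ρ u → InN[] G u x → x ≢ ρ → InN G ρ x
  N₃⇒InN (ρ~u , _)       (inj₁ refl) _   = ρ~u
  N₃⇒InN (ρ~u , ¬N₁ , _) (inj₂ u~x)  x≢ρ = InN[]⇒InN (¬N₁⇒N⊆N[] ρ~u ¬N₁ u~x) x≢ρ

  -- A neighbour x ≠ ρ of u having a neighbour outside N[ρ] would put u into N₂(ρ).
  N₃⇒N[]⊆N[] : ∀ {ρ u x} → N₃ G ρ u → InN[] G u x → x ≢ ρ → N[ x ]⊆N[ ρ ]
  N₃⇒N[]⊆N[] (ρ~u , ¬N₁ , _) (inj₁ refl) _ = N⊆N[]⇒N[]⊆N[] ρ~u (¬N₁⇒N⊆N[] ρ~u ¬N₁)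
  N₃⇒N[]⊆N[] {ρ} {x = x} N₃ρu@(ρ~u , ¬N₁ , ¬N₂) u~x@(inj₂ u~′x) x≢ρ =
    N⊆N[]⇒N[]⊆N[] ρ~x (¬N₁⇒N⊆N[] ρ~x ¬N₁ρx)
    where
    ρ~x : InN G ρ x
    ρ~x = N₃⇒InN N₃ρu u~x x≢ρ
    ¬N₁ρx : ¬ N₁ G ρ x
    ¬N₁ρx N₁ρx = ¬N₂ (ρ~u , ¬N₁ , x , u~′x , N₁ρx)

  -- canRef G u is definitionally foldr keepMax u (filterᵇ (inN[]ᵇ G u) (allFin n)).
  keepMax : Fin n → Fin n → Fin n
  keepMax v best = if keyLtᵇ G best v then v else best

  keepMax-⊀-new : ∀ v best → keepMax v best ⊀ v
  keepMax-⊀-new v best with keyLtᵇ G best v | keyLtᵇ-reflects best v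
  ... | true  | _          = ≺-irrefl
  ... | false | ofⁿ best⊀v = best⊀v

  keepMax-⊀-mono : ∀ v best {w} → best ⊀ w → keepMax v best ⊀ w
  keepMax-⊀-mono v best best⊀w with keyLtᵇ G best v | keyLtᵇ-reflects best v
  ... | true  | ofʸ best≺v = λ v≺w → best⊀w (≺-trans best≺v v≺w)
  ... | false | _          = best⊀w

  foldr-keepMax-maximal : ∀ init xs {v} → v ∈ init ∷ xs → foldr keepMax init xs ⊀ v
  foldr-keepMax-maximal init []       (here refl)         = ≺-irrefl
  foldr-keepMax-maximal init (x ∷ xs) (there (here refl)) = keepMax-⊀-new x _
  foldr-keepMax-maximal init (x ∷ xs) (here refl)         =
    keepMax-⊀-mono x _ (foldr-keepMax-maximal init xs (here refl))
  foldr-keepMax-maximal init (x ∷ xs) (there (there v∈))  =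
    keepMax-⊀-mono x _ (foldr-keepMax-maximal init xs (there v∈))

  canRef-maximal : ∀ {u v} → InN[] G u v → canRef G u ⊀ v
  canRef-maximal {u} {v} u~v = foldr-keepMax-maximal u _ (there v∈N[u])
    where
    v∈N[u] : v ∈ filterᵇ (inN[]ᵇ G u) (allFin n)
    v∈N[u] = ∈-filter⁺ (T? ∘ inN[]ᵇ G u) (∈-allFin v) (InN[]⇒T u~v)

  argmin-∷ : ∀ x xs →
             ∃ λ m → argmin G (x ∷ xs) ≡ just m × m ∈ x ∷ xs × (∀ {r} → r ∈ x ∷ xs → r ⊀ m)
  argmin-∷ x []       = x , refl , here refl , λ { (here refl) → ≺-irrefl }
  argmin-∷ x (y ∷ ys) with argmin G (y ∷ ys) | argmin-∷ y ys
  ... | _ | m , refl , m∈ , m-min with keyLtᵇ G m x | keyLtᵇ-reflects m x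
  ... | true  | ofʸ m≺x = m , refl , there m∈ , λ where
    (here refl) → ≺-asym m≺x
    (there r∈)  → m-min r∈
  ... | false | ofⁿ m⊀x = x , refl , here refl , λ where
    (here refl) → ≺-irrefl
    (there r∈)  → ⊀-trans (m-min r∈) m⊀x

  argmin-unique : ∀ {ρ xs} → ρ ∈ xs → (∀ {r} → r ∈ xs → r ⊀ ρ) → argmin G xs ≡ just ρ
  argmin-unique {xs = x ∷ xs} ρ∈ ρ-min with argmin-∷ x xs
  ... | m , argmin≡m , m∈ , m-min =
    trans argmin≡m (cong just (⊀-antisym (ρ-min m∈) (m-min ρ∈)))

  R≡just⇒canRef : ∀ {y r} → R G y ≡ just r → canRef G y ≡ r
  R≡just⇒canRef Ry≡r = just-injective (proj₂ (if-nothing≡just⇒T Ry≡r))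

  R-intro : ∀ {y} → canRef G y ≢ y → y N⊆N[ canRef G y ] → R G y ≡ just (canRef G y)
  R-intro {y} canRef≢y y⊆canRef =
    if-T (reflects⇒T (¬-reflects (⌊⌋-reflects (canRef G y ≟ y)) ×-reflects T-reflects _)
                     (canRef≢y , all⁻ _ (universal dominated (allFin n))))
    where
    dominated : ∀ w → T (not (adj y w) ∨ inN[]ᵇ G (canRef G y) w)
    dominated w =
      reflects⇒T (≡true-reflects (adj y w) →-reflects inN[]ᵇ-reflects (canRef G y) w) y⊆canRef

  InS⇒R≡just : ∀ {u ρ} → InS G u ρ → R G u ≡ just ρ
  InS⇒R≡just ((ρ~u , ¬N₁ , _) , refl) = R-intro (InN⇒≢ ρ~u) (¬N₁⇒N⊆N[] ρ~u ¬N₁)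

  inNWit-intro : ∀ {y r x} → R G y ≡ just r → InN[] G y x → T (inNWitᵇ G x)
  inNWit-intro {y} Ry≡r y~x =
    any⁺ _ (lose (∈-allFin y) (Equivalence.from T-∧ (R-defined , InN[]⇒T y~x)))
    where
    R-defined : T (is-just (R G y))
    R-defined = subst (T ∘ is-just) (sym Ry≡r) _

  open import Data.List.Membership.DecPropositional (_≟_ {n}) using (_∈?_)

  -- refs is defined through helpers local to Defs, which cannot be named here.  Their
  -- unfolding at y is reached through a hypothesis instead (by contradiction for ∈-refs⁺),
  -- with the condition b supplied explicitly so that R G y stays visible for `with`.
  ∈-refs⁻ : ∀ {x r} → r ∈ refs G x → ∃ λ y → InN[] G x y × R G y ≡ just r
  ∈-refs⁻ {x} r∈ with ∈-mapMaybe⁻ _ {allFin n} r∈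
  ... | y , _ , pick≡r with if-nothing≡just⇒T {b = inN[]ᵇ G x y} pick≡r
  ... | x~y , pickR≡r with R G y in Ry≡ | pickR≡r
  ... | just r′ | pickR′≡r =
    y , T⇒reflected (inN[]ᵇ-reflects x y) x~y , trans Ry≡ (proj₂ (if-nothing≡just⇒T pickR′≡r))
  ... | nothing | ()

  ∈-refs⁺ : ∀ {x y r} → InN[] G x y → R G y ≡ just r → InN G x r → r ∈ refs G x
  ∈-refs⁺ {x} {y} {r} x~y Ry≡r x~r with r ∈? refs G x
  ... | yes r∈ = r∈
  ... | no r∉
    with if-then-≢ {b = inN[]ᵇ G x y} (InN[]⇒T x~y)
                   (contraposition (∈-mapMaybe⁺ _ {allFin n} (∈-allFin y)) r∉)
  ... | pickR≢r with R G y | Ry≡r | pickR≢r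
  ... | _ | refl | pickR′≢r =
    contradiction (if-T (reflects⇒T (≡true-reflects _) x~r)) pickR′≢r

mainTheorem6 : (n : ℕ) (G : Graph n) → ProperlyPartitioning G (f G)
mainTheorem6 n G u ρ uρ∈S@(N₃ρu , _) x u~x x≢ρ = begin
    f G x               ≡⟨ if-T (inNWit-intro Ru≡ρ u~x) ⟩
    argmin G (refs G x) ≡⟨ argmin-unique ρ∈refs ρ-minimal ⟩
    just ρ              ∎
  where
  open ≡-Reasoning
  open Partition G
  Ru≡ρ : R G u ≡ just ρ
  Ru≡ρ = InS⇒R≡just uρ∈S
  ρ~x : InN G ρ x
  ρ~x = N₃⇒InN N₃ρu u~x x≢ρ
  N[x]⊆N[ρ] : N[ x ]⊆N[ ρ ]
  N[x]⊆N[ρ] = N₃⇒N[]⊆N[] N₃ρu u~x x≢ρ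
  ρ∈refs : ρ ∈ refs G x
  ρ∈refs = ∈-refs⁺ (InN[]-sym u~x) Ru≡ρ (InN-sym ρ~x)
  ρ-minimal : ∀ {r} → r ∈ refs G x → r ⊀ ρ
  ρ-minimal r∈ with ∈-refs⁻ r∈
  ... | y , x~y , Ry≡r =
    subst (_⊀ ρ) (R≡just⇒canRef Ry≡r) (canRef-maximal (InN[]-sym (N[x]⊆N[ρ] x~y)))
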